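{- Let $m\geq 2$ and $n\geq 4$ with $n$ even, and fix a Dyck word $u\in D_{n-2}$. Let $L_{m\times n}$ be the set of all binary $m\times n$ matrices $A$ with rows $A_1,\dots,A_m$ (each read as a binary string of length $n$) such that: (i) $A_1=1u0$ (the same first row for every matrix of the set), and $A_i\neq 1u0$ for every $i=2,\dots,m$; (ii) for each $i=2,\dots,m-1$, the row $A_i$ is of one of the following forms: (type 1) $A_i\in D_n$; (type 2) $A_i=11w$ with $w\in D_{n-2}$, $w\neq u$; (type 3) $A_i=w00$ with $w\in D_{n-2}$, $w\neq u$; (type 4) $A_i=01w$ with $w\in D_{n-2}$, $w\neq u$; (type 5) $A_i=0w0$ with $w\in D_{n-2}$; (iii) the last row $A_m$ is of type 1, type 2 or type 3. Then $L_{m\times n}$ is a non-overlapping set of matrices.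
   Context: For $\ell\geq 1$, a Dyck word of length $2\ell$ is a binary string $v$ of length $2\ell$ with equally many $1$'s and $0$'s such that every prefix of $v$ contains at least as many $1$'s as $0$'s; $D_{2\ell}$ denotes the set of Dyck words of length $2\ell$. Concatenation of strings is written by juxtaposition. Two binary $m\times n$ matrices $A=(a_{i,j})$ and $B=(b_{i,j})$ overlap at shift $(p,q)\in\mathbb{Z}^2$ with $|p|\leq m-1$, $|q|\leq n-1$ if $a_{i,j}=b_{i+p,j+q}$ for all $(i,j)$ with $1\leq i,i+p\leq m$ and $1\leq j,j+q\leq n$ (i.e., after rigidly translating one matrix over the other, without rotation, all entries in the common rectangular region coincide). Two distinct matrices $A,B$ are non-overlapping if they overlap at no such shift; a matrix $A$ is self non-overlapping if $A$ and $A$ overlap at no such shift with $(p,q)\neq(0,0)$. A set of $m\times n$ matrices is non-overlapping if each of its matrices is self non-overlapping and any two distinct matrices in it are non-overlapping. -}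

module Defs where

open import Data.Bool using (Bool; true; false)
open import Data.Nat using (ℕ; zero; suc; _+_; _*_; _≤_; _<_)
open import Data.Integer as ℤ using (ℤ; +_; ∣_∣)
open import Data.List using (List; []; _∷_; _++_; length; take; filter; [_])
open import Data.Fin using (Fin; toℕ)
open import Data.Vec using (Vec; lookup; toList)
open import Data.Product using (_×_; Σ; ∃)
open import Data.Sum using (_⊎_)
open import Relation.Binary.PropositionalEquality using (_≡_; _≢_)
open import Relation.Nullary using (¬_)

-- binary strings: List Bool, with true = 1, false = 0
count1 : List Bool → ℕ
count1 [] = 0
count1 (true ∷ v) = suc (count1 v)
count1 (false ∷ v) = count1 v

count0 : List Bool → ℕ
count0 [] = 0
count0 (true ∷ v) = count0 v
count0 (false ∷ v) = suc (count0 v)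

IsDyck : ℕ → List Bool → Set
IsDyck len v = (Σ ℕ λ ℓ → 1 ≤ ℓ × len ≡ 2 * ℓ)
             × length v ≡ len
             × count1 v ≡ count0 v
             × (∀ k → count0 (take k v) ≤ count1 (take k v))

-- Binary m × n matrices; entries indexed from 0.
Matrix : ℕ → ℕ → Set
Matrix m n = Vec (Vec Bool n) m

entry : ∀ {m n} → Matrix m n → Fin m → Fin n → Bool
entry A i j = lookup (lookup A i) j

OverlapAt : ∀ {m n} → Matrix m n → Matrix m n → ℤ → ℤ → Set
OverlapAt {m} {n} A B p q =
  ∀ (i i' : Fin m) (j j' : Fin n) →
    + toℕ i' ≡ + toℕ i ℤ.+ p → + toℕ j' ≡ + toℕ j ℤ.+ q →
    entry A i j ≡ entry B i' j'

AdmissibleShift : ℕ → ℕ → ℤ → ℤ → Set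
AdmissibleShift m n p q = suc ∣ p ∣ ≤ m × suc ∣ q ∣ ≤ n

NonOverlapping : ∀ {m n} → Matrix m n → Matrix m n → Set
NonOverlapping {m} {n} A B =
  ∀ p q → AdmissibleShift m n p q → ¬ OverlapAt A B p q

SelfNonOverlapping : ∀ {m n} → Matrix m n → Set
SelfNonOverlapping {m} {n} A =
  ∀ p q → AdmissibleShift m n p q → ¬ (p ≡ + 0 × q ≡ + 0) → ¬ OverlapAt A A p q

NonOverlappingSet : ∀ {m n} → (Matrix m n → Set) → Set
NonOverlappingSet {m} {n} S =
  (∀ A → S A → SelfNonOverlapping A) ×
  (∀ A B → S A → S B → A ≢ B → NonOverlapping A B)

Type1 : ℕ → List Bool → Set
Type1 n r = IsDyck n r

Type2 : ℕ → List Bool → List Bool → Set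
Type2 n u r = Σ (List Bool) λ w → IsDyck (n Data.Nat.∸ 2) w × w ≢ u × r ≡ true ∷ true ∷ w

Type3 : ℕ → List Bool → List Bool → Set
Type3 n u r = Σ (List Bool) λ w → IsDyck (n Data.Nat.∸ 2) w × w ≢ u × r ≡ w ++ false ∷ false ∷ []

Type4 : ℕ → List Bool → List Bool → Set
Type4 n u r = Σ (List Bool) λ w → IsDyck (n Data.Nat.∸ 2) w × w ≢ u × r ≡ false ∷ true ∷ w

Type5 : ℕ → List Bool → Set
Type5 n r = Σ (List Bool) λ w → IsDyck (n Data.Nat.∸ 2) w × r ≡ false ∷ w ++ false ∷ []

row : ∀ {m n} → Matrix m n → Fin m → List Bool
row A i = toList (lookup A i)

-- the set L_{m×n} (for the fixed u), as a predicate; rows indexed 0..m-1,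
-- so paper's row 1 is index 0 and row m is index m-1.
InL : (m n : ℕ) → List Bool → Matrix m n → Set
InL m n u A =
  (∀ i → toℕ i ≡ 0 → row A i ≡ true ∷ u ++ false ∷ []) ×
  (∀ i → 1 ≤ toℕ i → row A i ≢ true ∷ u ++ false ∷ []) ×
  (∀ i → 1 ≤ toℕ i → suc (toℕ i) < m →
     Type1 n (row A i) ⊎ Type2 n u (row A i) ⊎ Type3 n u (row A i)
       ⊎ Type4 n u (row A i) ⊎ Type5 n (row A i)) ×
  (∀ i → suc (toℕ i) ≡ m →
     Type1 n (row A i) ⊎ Type2 n u (row A i) ⊎ Type3 n u (row A i))

module Submission where

-- The argument counts letters in the rows, read as binary words.  Write
-- R = 1u0.  Every proper nonempty prefix of R has strictly more 1s than 0s
-- and every proper nonempty suffix strictly more 0s than 1s (frame-prefix,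
-- frame-suffix).  Rows of the five admissible types are almost Dyck words:
-- their suffixes from the third letter on have at least as many 0s, their
-- prefixes of length 2..n-1 at least as many 1s; the exceptions are exactly
-- the words excluded by the conditions w ≠ u, and the last row starts with 1.
--
-- For p = 0 this compares R with itself, for
-- p > 0 it compares R with a lower row (or, when |q| = n - 1, the last row
-- with a row ending in 0); in each case the letter counts disagree.  Negative
-- p reduces to positive p by swapping the matrices (overlap-sym).  So only the
-- shift (0 , 0) survives, where overlapping means equality.

open import Defs
open import Data.Bool using (Bool; true; false)
open import Data.Nat using (ℕ; zero; suc; _+_; _*_; _∸_; _≤_; _<_; z≤n; s≤s)
open import Data.Nat.Properties
open import Data.List using (List; []; _∷_; _++_; take; drop; length)
open import Data.List.Properties
  using (take-all; take++drop≡id; drop-[]; drop-drop; length-++; ∷-injectiveʳ; ∷ʳ-injectiveˡ)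
open import Data.Fin using (Fin; toℕ; fromℕ; fromℕ<) renaming (zero to fzero; suc to fsuc)
open import Data.Fin.Properties using (toℕ-fromℕ; toℕ-fromℕ<; toℕ<n)
open import Data.Vec using (Vec; lookup; toList; []; _∷_)
open import Data.Vec.Properties using (tabulate∘lookup; tabulate-cong)
open import Data.Integer as ℤ using (ℤ; +_; -[1+_]; ∣_∣)
import Data.Integer.Properties as ℤP
open import Data.Product using (Σ; ∃; _×_; _,_)
open import Data.Sum using (_⊎_; inj₁; inj₂)
open import Data.Empty using (⊥-elim)
open import Relation.Binary.PropositionalEquality
open import Relation.Nullary using (¬_; yes; no)

count1-++ : ∀ x y → count1 (x ++ y) ≡ count1 x + count1 y
count1-++ []          y = refl
count1-++ (true ∷ x)  y = cong suc (count1-++ x y)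
count1-++ (false ∷ x) y = count1-++ x y

count0-++ : ∀ x y → count0 (x ++ y) ≡ count0 x + count0 y
count0-++ []          y = refl
count0-++ (true ∷ x)  y = count0-++ x y
count0-++ (false ∷ x) y = cong suc (count0-++ x y)

OneHeavy ZeroHeavy MoreOnes MoreZeros : List Bool → Set
OneHeavy  v = count0 v ≤ count1 v
ZeroHeavy v = count1 v ≤ count0 v
MoreOnes  v = count0 v < count1 v
MoreZeros v = count1 v < count0 v

-- Two words whose letter counts compare in opposite directions are different;
-- every contradiction below is an instance of this.
majority-clash : ∀ {x y} (f g : List Bool → ℕ) → f x < g x → g y ≤ f y → x ≢ y
majority-clash f g lt le refl = <⇒≱ lt le

ones-vs-zeros : ∀ {x y} → MoreOnes x → ZeroHeavy y → x ≢ y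
ones-vs-zeros = majority-clash count0 count1

zeros-vs-ones : ∀ {x y} → OneHeavy x → MoreZeros y → x ≢ y
zeros-vs-ones x-ones y-zeros x≡y = majority-clash count1 count0 y-zeros x-ones (sym x≡y)

PrefixCondition SuffixCondition : List Bool → Set
PrefixCondition v = ∀ k → OneHeavy (take k v)
SuffixCondition v = ∀ k → ZeroHeavy (drop k v)

balanced-suffixes : ∀ w → count1 w ≡ count0 w → PrefixCondition w → SuffixCondition w
balanced-suffixes w balanced prefixes k =
  +-cancelˡ-≤ (count0 front) (count1 back) (count0 back) shifted
  where
  front = take k w
  back = drop k w
  open ≤-Reasoning
  shifted : count0 front + count1 back ≤ count0 front + count0 back
  shifted = begin
    count0 front + count1 back ≤⟨ +-monoˡ-≤ (count1 back) (prefixes k) ⟩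
    count1 front + count1 back ≡⟨ sym (count1-++ front back) ⟩
    count1 (front ++ back)     ≡⟨ cong count1 (take++drop≡id k w) ⟩
    count1 w                   ≡⟨ balanced ⟩
    count0 w                   ≡⟨ cong count0 (sym (take++drop≡id k w)) ⟩
    count0 (front ++ back)     ≡⟨ count0-++ front back ⟩
    count0 front + count0 back ∎

suffixes-++ : ∀ x y → SuffixCondition x → SuffixCondition y → SuffixCondition (x ++ y)
suffixes-++ x y sx sy zero = begin
    count1 (x ++ y)     ≡⟨ count1-++ x y ⟩
    count1 x + count1 y ≤⟨ +-mono-≤ (sx 0) (sy 0) ⟩
    count0 x + count0 y ≡⟨ sym (count0-++ x y) ⟩
    count0 (x ++ y)     ∎
  where open ≤-Reasoning
suffixes-++ []      y sx sy (suc k) = sy (suc k)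
suffixes-++ (_ ∷ x) y sx sy (suc k) = suffixes-++ x y (λ i → sx (suc i)) sy k

suffixes-0 : SuffixCondition (false ∷ [])
suffixes-0 zero = z≤n
suffixes-0 (suc k) rewrite drop-[] {A = Bool} k = z≤n

prefixes-1∷ : ∀ {x} → PrefixCondition x → PrefixCondition (true ∷ x)
prefixes-1∷ prefixes zero    = z≤n
prefixes-1∷ prefixes (suc k) = m≤n⇒m≤1+n (prefixes k)

dyck-length : ∀ {K w} → IsDyck K w → length w ≡ K
dyck-length (_ , len , _) = len

dyck-prefixes : ∀ {K w} → IsDyck K w → PrefixCondition w
dyck-prefixes (_ , _ , _ , prefixes) = prefixes

dyck-suffixes : ∀ {K w} → IsDyck K w → SuffixCondition w
dyck-suffixes {w = w} (_ , _ , balanced , prefixes) = balanced-suffixes w balanced prefixes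

dyck-positive-length : ∀ {K w} → IsDyck K w → 1 ≤ K
dyck-positive-length ((ℓ , 1≤ℓ , K≡2ℓ) , _) =
  subst (1 ≤_) (sym K≡2ℓ) (≤-trans 1≤ℓ (m≤m+n ℓ (ℓ + 0)))

dyck-starts-with-1 : ∀ {K w} → IsDyck K w → ∃ λ ws → w ≡ true ∷ ws
dyck-starts-with-1 {w = []} d with dyck-positive-length d | dyck-length d
... | 1≤K | refl with 1≤K
... | ()
dyck-starts-with-1 {w = true ∷ ws} d = ws , refl
dyck-starts-with-1 {w = false ∷ ws} d with dyck-prefixes d 1
... | ()

take-++ˡ : ∀ k (x y : List Bool) → k ≤ length x → take k (x ++ y) ≡ take k x
take-++ˡ zero    x       y _         = refl
take-++ˡ (suc k) (a ∷ x) y (s≤s k≤) = cong (a ∷_) (take-++ˡ k x y k≤)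

drop-++ˡ : ∀ k (x y : List Bool) → k ≤ length x → drop k (x ++ y) ≡ drop k x ++ y
drop-++ˡ zero    x       y _         = refl
drop-++ˡ (suc k) (a ∷ x) y (s≤s k≤) = drop-++ˡ k x y k≤

take-suc-length : ∀ (x : List Bool) a y → take (suc (length x)) (x ++ a ∷ y) ≡ x ++ a ∷ []
take-suc-length []      a y = refl
take-suc-length (b ∷ x) a y = cong (b ∷_) (take-suc-length x a y)

drop-suc : ∀ k (x : List Bool) → drop 1 (drop k x) ≡ drop (suc k) x
drop-suc k x = trans (drop-drop k 1 x) (cong (λ i → drop i x) (+-comm k 1))

frame : List Bool → List Bool
frame u = true ∷ u ++ false ∷ []

frame-length : ∀ u → length (frame u) ≡ suc (suc (length u))
frame-length u = cong suc (trans (length-++ u) (+-comm (length u) 1))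

frame-prefix : ∀ {u} → PrefixCondition u → ∀ j → j ≤ length u →
  MoreOnes (take (suc j) (frame u))
frame-prefix {u} prefixes j j≤ rewrite take-++ˡ j u (false ∷ []) j≤ = s≤s (prefixes j)

frame-suffix : ∀ {u} → SuffixCondition u → ∀ k → k ≤ length u →
  MoreZeros (drop (suc k) (frame u))
frame-suffix {u} suffixes k k≤
  rewrite drop-++ˡ k u (false ∷ []) k≤
        | count1-++ (drop k u) (false ∷ []) | count0-++ (drop k u) (false ∷ [])
  = +-mono-≤-< (suffixes k) (s≤s z≤n)

frame-take-body : ∀ u {j} → j ≡ length u → take (suc j) (frame u) ≡ true ∷ u
frame-take-body u refl =
  cong (true ∷_) (trans (take-++ˡ (length u) u _ ≤-refl) (take-all (length u) u ≤-refl))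

complement : ∀ {k N} → k ≤ N → ∃ λ j → j + k ≡ N
complement k≤N with m≤n⇒∃[o]m+o≡n k≤N
... | j , k+j≡N = j , trans (+-comm j _) k+j≡N

sum∸ : ∀ {j k n} → j + k ≡ n → n ∸ k ≡ j
sum∸ {j} {k} refl = m+n∸n≡m j k

shift-back : ∀ {x y : ℤ} p → y ≡ x ℤ.+ p → x ≡ y ℤ.+ ℤ.- p
shift-back {x} {y} p y≡x+p = begin
  x                     ≡⟨ sym (ℤP.+-identityʳ x) ⟩
  x ℤ.+ + 0             ≡⟨ cong (λ z → x ℤ.+ z) (sym (ℤP.+-inverseʳ p)) ⟩
  x ℤ.+ (p ℤ.+ ℤ.- p)   ≡⟨ sym (ℤP.+-assoc x p (ℤ.- p)) ⟩
  (x ℤ.+ p) ℤ.+ ℤ.- p   ≡⟨ cong (λ z → z ℤ.+ ℤ.- p) (sym y≡x+p) ⟩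
  y ℤ.+ ℤ.- p           ∎
  where open ≡-Reasoning

shifted-agreement : ∀ {A : Set} {a b} (x : Vec A a) (y : Vec A b) k → b ∸ k ≤ a →
  (∀ c c' → toℕ c' ≡ toℕ c + k → lookup x c ≡ lookup y c') →
  take (b ∸ k) (toList x) ≡ drop k (toList y)
shifted-agreement x       []      zero    _         _ = refl
shifted-agreement []      (_ ∷ _) zero    ()        _
shifted-agreement (d ∷ x) (e ∷ y) zero    (s≤s b≤a) agree =
  cong₂ _∷_ (agree fzero fzero refl)
    (shifted-agreement x y zero b≤a (λ c c' c'≡c → agree (fsuc c) (fsuc c') (cong suc c'≡c)))
shifted-agreement x       []      (suc k) _         _ = refl
shifted-agreement x       (e ∷ y) (suc k) le        agree =
  shifted-agreement x y k le
    (λ c c' c'≡c+k → agree c (fsuc c') (trans (cong suc c'≡c+k) (sym (+-suc (toℕ c) k))))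

overlap-sym : ∀ {m n} (A B : Matrix m n) p q → OverlapAt A B p q → OverlapAt B A (ℤ.- p) (ℤ.- q)
overlap-sym A B p q ov i i' j j' i'≡i-p j'≡j-q =
  sym (ov i' i j' j (unshift p i'≡i-p) (unshift q j'≡j-q))
  where
  unshift : ∀ r {x y} → y ≡ x ℤ.+ ℤ.- r → x ≡ y ℤ.+ r
  unshift r {x} {y} e = subst (λ s → x ≡ y ℤ.+ s) (ℤP.neg-involutive r) (shift-back (ℤ.- r) e)

overlap-at-origin⇒≡ : ∀ {m n} (A B : Matrix m n) → OverlapAt A B (+ 0) (+ 0) → A ≡ B
overlap-at-origin⇒≡ A B ov =
  vec-ext A B (λ i → vec-ext _ _ (λ j → ov i i j j (origin i) (origin j)))
  where
  origin : ∀ {r} (c : Fin r) → + toℕ c ≡ + toℕ c ℤ.+ + 0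
  origin c = cong +_ (sym (+-identityʳ (toℕ c)))
  vec-ext : ∀ {X : Set} {r} (x y : Vec X r) → (∀ c → lookup x c ≡ lookup y c) → x ≡ y
  vec-ext x y pointwise =
    trans (sym (tabulate∘lookup x)) (trans (tabulate-cong pointwise) (tabulate∘lookup y))

module Rows (N : ℕ) (u : List Bool) (du : IsDyck N u) where

  n : ℕ
  n = suc (suc N)

  R : List Bool
  R = frame u

  MiddleRow LastRow : List Bool → Set
  MiddleRow s = Type1 n s ⊎ Type2 n u s ⊎ Type3 n u s ⊎ Type4 n u s ⊎ Type5 n s
  LastRow s = Type1 n s ⊎ Type2 n u s ⊎ Type3 n u s

  last⇒middle : ∀ {s} → LastRow s → MiddleRow s
  last⇒middle (inj₁ t1)        = inj₁ t1
  last⇒middle (inj₂ (inj₁ t2)) = inj₂ (inj₁ t2)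
  last⇒middle (inj₂ (inj₂ t3)) = inj₂ (inj₂ (inj₁ t3))

  left≤ : ∀ {j k} → j + k ≡ N → j ≤ length u
  left≤ {j} {k} e = subst (j ≤_) (trans e (sym (dyck-length du))) (m≤m+n j k)

  right≤ : ∀ {j k} → j + k ≡ N → k ≤ length u
  right≤ {j} {k} e = subst (k ≤_) (trans e (sym (dyck-length du))) (m≤n+m k j)

  frame-unbordered : ∀ j k → j + k ≡ N → take (suc j) R ≢ drop (suc k) R
  frame-unbordered j k e = ones-vs-zeros
    (frame-prefix (dyck-prefixes du) j (left≤ e))
    (<⇒≤ (frame-suffix (dyck-suffixes du) k (right≤ e)))

  middle-row-suffix-shape : ∀ {s} → MiddleRow s →
    SuffixCondition s ⊎ Σ (List Bool) λ w → IsDyck N w × w ≢ u × ∃ λ b → s ≡ b ∷ true ∷ w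
  middle-row-suffix-shape (inj₁ d) = inj₁ (dyck-suffixes d)
  middle-row-suffix-shape (inj₂ (inj₁ (w , dw , w≢u , refl))) = inj₂ (w , dw , w≢u , true , refl)
  middle-row-suffix-shape (inj₂ (inj₂ (inj₁ (w , dw , _ , refl)))) =
    inj₁ (suffixes-++ w _ (dyck-suffixes dw) (suffixes-++ (false ∷ []) _ suffixes-0 suffixes-0))
  middle-row-suffix-shape (inj₂ (inj₂ (inj₂ (inj₁ (w , dw , w≢u , refl))))) =
    inj₂ (w , dw , w≢u , false , refl)
  middle-row-suffix-shape (inj₂ (inj₂ (inj₂ (inj₂ (w , dw , refl))))) =
    inj₁ (suffixes-++ (false ∷ []) _ suffixes-0 (suffixes-++ w _ (dyck-suffixes dw) suffixes-0))

  middle-row-suffixes : ∀ {s} → MiddleRow s → ∀ k → 2 ≤ k → ZeroHeavy (drop k s)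
  middle-row-suffixes r (suc zero) (s≤s ())
  middle-row-suffixes r (suc (suc k)) _ with middle-row-suffix-shape r
  ... | inj₁ suffixes = suffixes (suc (suc k))
  ... | inj₂ (w , dw , _ , _ , refl) = dyck-suffixes dw k

  last-row-starts-with-1 : ∀ {s} → LastRow s → MoreOnes (take 1 s)
  last-row-starts-with-1 (inj₁ d) with dyck-starts-with-1 d
  ... | _ , refl = s≤s z≤n
  last-row-starts-with-1 (inj₂ (inj₁ (_ , _ , _ , refl))) = s≤s z≤n
  last-row-starts-with-1 (inj₂ (inj₂ (_ , dw , _ , refl))) with dyck-starts-with-1 dw
  ... | _ , refl = s≤s z≤n

  -- Rows of types 2 and 4: from the second letter on, b1w is 1w ≠ 1u, and
  -- from the third letter on it is a suffix of the Dyck word w.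
  frame-prefix≢b1w-suffix : ∀ {w} → IsDyck N w → w ≢ u → ∀ b j k → j + k ≡ N →
    take (suc j) R ≢ drop (suc k) (b ∷ true ∷ w)
  frame-prefix≢b1w-suffix dw w≢u b j zero e 1u≡1w =
    w≢u (sym (∷-injectiveʳ (trans (sym (frame-take-body u j≡N)) 1u≡1w)))
    where
    j≡N : j ≡ length u
    j≡N = trans (sym (+-identityʳ j)) (trans e (sym (dyck-length du)))
  frame-prefix≢b1w-suffix dw w≢u b j (suc k) e =
    ones-vs-zeros (frame-prefix (dyck-prefixes du) j (left≤ e)) (dyck-suffixes dw k)

  frame-prefix≢row-suffix : ∀ {s} → MiddleRow s → s ≢ R → ∀ j k → j + k ≡ suc N →
    take (suc j) R ≢ drop k s
  frame-prefix≢row-suffix r s≢R j zero e R≡s =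
    s≢R (trans (sym R≡s) (take-all (suc j) R (≤-reflexive R-fits)))
    where
    j≡sN : j ≡ suc N
    j≡sN = trans (sym (+-identityʳ j)) e
    R-fits : length R ≡ suc j
    R-fits = trans (frame-length u) (cong suc (trans (cong suc (dyck-length du)) (sym j≡sN)))
  frame-prefix≢row-suffix r s≢R j (suc k) e
    with middle-row-suffix-shape r | suc-injective (trans (sym (+-suc j k)) e)
  ... | inj₁ suffixes | j+k≡N =
    ones-vs-zeros (frame-prefix (dyck-prefixes du) j (left≤ j+k≡N)) (suffixes (suc k))
  ... | inj₂ (w , dw , w≢u , b , refl) | j+k≡N = frame-prefix≢b1w-suffix dw w≢u b j k j+k≡N

  frame-tail : ∀ j k → j + suc k ≡ N → MoreZeros (drop (suc k) R)
  frame-tail j k e = frame-suffix (dyck-suffixes du) k (<⇒≤ (right≤ e))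

  -- Rows of type 3: against R shifted by one letter, w00 would give w0 = u0;
  -- shorter prefixes are prefixes of the Dyck word w.
  type3-prefix≢frame-suffix : ∀ {w} → IsDyck N w → w ≢ u → ∀ j k → j + suc k ≡ N →
    take (2 + j) (w ++ false ∷ false ∷ []) ≢ drop (suc k) R
  type3-prefix≢frame-suffix {w} dw w≢u j zero e w0≡u0 =
    w≢u (∷ʳ-injectiveˡ w u (trans (sym prefix≡w0) w0≡u0))
    where
    sj≡length-w : suc j ≡ length w
    sj≡length-w = trans (trans (+-comm 1 j) e) (sym (dyck-length dw))
    prefix≡w0 : take (2 + j) (w ++ false ∷ false ∷ []) ≡ w ++ false ∷ []
    prefix≡w0 rewrite sj≡length-w = take-suc-length w false (false ∷ [])
  type3-prefix≢frame-suffix {w} dw w≢u j (suc k) e = zeros-vs-ones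
    (subst OneHeavy (sym (take-++ˡ (2 + j) w _ fits)) (dyck-prefixes dw (2 + j)))
    (frame-tail j (suc k) e)
    where
    fits : 2 + j ≤ length w
    fits = subst (2 + j ≤_) (trans (sym two-sucs) (trans e (sym (dyck-length dw))))
      (s≤s (s≤s (m≤m+n j k)))
      where
      two-sucs : j + suc (suc k) ≡ suc (suc (j + k))
      two-sucs = trans (+-suc j (suc k)) (cong suc (+-suc j k))

  -- Rows of type 5: dropping the first letter on both sides compares a prefix
  -- of the Dyck word w with a proper suffix of R.
  type5-prefix≢frame-suffix : ∀ {w} → IsDyck N w → ∀ j k → j + suc k ≡ N →
    take (2 + j) (false ∷ w ++ false ∷ []) ≢ drop (suc k) R
  type5-prefix≢frame-suffix {w} dw j k e eq = zeros-vs-ones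
    (subst OneHeavy (sym (take-++ˡ (suc j) w _ fits)) (dyck-prefixes dw (suc j)))
    (frame-suffix (dyck-suffixes du) (suc k) (right≤ e))
    (trans (cong (drop 1) eq) (drop-suc (suc k) R))
    where
    fits : suc j ≤ length w
    fits = subst (suc j ≤_) (trans (sym (+-suc j k)) (trans e (sym (dyck-length dw)))) (s≤s (m≤m+n j k))

  row-prefix≢frame-suffix : ∀ {s} → MiddleRow s → ∀ j k → j + suc k ≡ N →
    take (2 + j) s ≢ drop (suc k) R
  row-prefix≢frame-suffix (inj₁ d) j k e =
    zeros-vs-ones (dyck-prefixes d (2 + j)) (frame-tail j k e)
  row-prefix≢frame-suffix (inj₂ (inj₁ (w , dw , _ , refl))) j k e =
    zeros-vs-ones (prefixes-1∷ (prefixes-1∷ (dyck-prefixes dw)) (2 + j)) (frame-tail j k e)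
  row-prefix≢frame-suffix (inj₂ (inj₂ (inj₁ (w , dw , w≢u , refl)))) =
    type3-prefix≢frame-suffix dw w≢u
  row-prefix≢frame-suffix (inj₂ (inj₂ (inj₂ (inj₁ (w , dw , _ , refl))))) j k e =
    zeros-vs-ones (s≤s (dyck-prefixes dw j)) (frame-tail j k e)
  row-prefix≢frame-suffix (inj₂ (inj₂ (inj₂ (inj₂ (w , dw , refl))))) =
    type5-prefix≢frame-suffix dw

  first-row : ∀ {m} (A : Matrix m n) → InL m n u A → ∀ i → toℕ i ≡ 0 → row A i ≡ R
  first-row A (first , _) = first

  lower-row≢frame : ∀ {m} (A : Matrix m n) → InL m n u A → ∀ i → 1 ≤ toℕ i → row A i ≢ R
  lower-row≢frame A (_ , distinct , _) = distinct

  last-row : ∀ {m} (A : Matrix m n) → InL m n u A → ∀ i → suc (toℕ i) ≡ m → LastRow (row A i)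
  last-row A (_ , _ , _ , last) = last

  lower-row-is-middle : ∀ {m} (A : Matrix m n) → InL m n u A → ∀ i → 1 ≤ toℕ i →
    MiddleRow (row A i)
  lower-row-is-middle {m} A (_ , _ , middle , last) i 1≤i with suc (toℕ i) ≟ m
  ... | yes is-last = last⇒middle (last i is-last)
  ... | no not-last = middle i 1≤i (≤∧≢⇒< (toℕ<n i) not-last)

  row-tail : ∀ {m} (A : Matrix m n) → InL m n u A → ∀ i → ZeroHeavy (drop (suc N) (row A i))
  row-tail A L fzero = subst (λ s → ZeroHeavy (drop (suc N) s)) (sym (first-row A L fzero refl))
    (<⇒≤ (frame-suffix (dyck-suffixes du) N (≤-reflexive (sym (dyck-length du)))))
  row-tail A L i@(fsuc _) = middle-row-suffixes (lower-row-is-middle A L i (s≤s z≤n)) (suc N)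
    (s≤s (dyck-positive-length du))

  overlap-rows⁺ : ∀ {m} (A B : Matrix m n) {a k} → OverlapAt A B (+ a) (+ k) →
    ∀ {i i'} → toℕ i' ≡ toℕ i + a → ∀ j → j + k ≡ n →
    take j (row A i) ≡ drop k (row B i')
  overlap-rows⁺ A B {k = k} ov {i} {i'} i'≡i+a j j+k≡n =
    subst (λ l → take l (row A i) ≡ drop k (row B i')) (sum∸ j+k≡n)
      (shifted-agreement (lookup A i) (lookup B i') k (m∸n≤m n k)
        (λ c c' c'≡c+k → ov i i' c c' (cong +_ i'≡i+a) (cong +_ c'≡c+k)))

  overlap-rows⁻ : ∀ {m} (A B : Matrix m n) {a k} → OverlapAt A B (+ a) -[1+ k ] →
    ∀ {i i'} → toℕ i' ≡ toℕ i + a → ∀ j → j + suc k ≡ n →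
    take j (row B i') ≡ drop (suc k) (row A i)
  overlap-rows⁻ A B {k = k} ov {i} {i'} i'≡i+a j j+k≡n =
    subst (λ l → take l (row B i') ≡ drop (suc k) (row A i)) (sum∸ j+k≡n)
      (shifted-agreement (lookup B i') (lookup A i) (suc k) (m∸n≤m n (suc k))
        (λ c' c c≡c'+k →
          sym (ov i i' c c' (cong +_ i'≡i+a) (shift-back (+ suc k) (cong +_ c≡c'+k)))))

  -- Shift (0 , k+1): the first rows would make R bordered.
  no-horizontal-overlap : ∀ {m} (A B : Matrix m n) {k} → InL m n u A → InL m n u B →
    AdmissibleShift m n (+ 0) (+ suc k) → ¬ OverlapAt A B (+ 0) (+ suc k)
  no-horizontal-overlap A B {k} LA LB (s≤s _ , s≤s (s≤s k≤N)) ov with complement k≤N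
  ... | j , j+k≡N = frame-unbordered j k j+k≡N (begin
      take (suc j) R             ≡⟨ cong (take (suc j)) (sym (first-row A LA fzero refl)) ⟩
      take (suc j) (row A fzero) ≡⟨ overlap-rows⁺ A B ov refl (suc j) lengths ⟩
      drop (suc k) (row B fzero) ≡⟨ cong (drop (suc k)) (first-row B LB fzero refl) ⟩
      drop (suc k) R             ∎)
    where
    open ≡-Reasoning
    lengths : suc j + suc k ≡ n
    lengths = cong suc (trans (+-suc j k) (cong suc j+k≡N))

  -- Shift (a+1 , k) with k ≥ 0: the first row R of A against row a+1 of B.
  no-vertical-overlap⁺ : ∀ {m} (A B : Matrix m n) {a k} → InL m n u A → InL m n u B →
    suc (suc a) ≤ m → suc k ≤ n → ¬ OverlapAt A B (+ suc a) (+ k)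
  no-vertical-overlap⁺ A B {a} {k} LA LB a<m@(s≤s _) (s≤s k≤sN) ov with complement k≤sN
  ... | j , j+k≡sN =
    frame-prefix≢row-suffix (lower-row-is-middle B LB i below) (lower-row≢frame B LB i below) j k j+k≡sN
      (begin
        take (suc j) R             ≡⟨ cong (take (suc j)) (sym (first-row A LA fzero refl)) ⟩
        take (suc j) (row A fzero) ≡⟨ overlap-rows⁺ A B ov row-gap (suc j) (cong suc j+k≡sN) ⟩
        drop k (row B i)           ∎)
    where
    open ≡-Reasoning
    i = fromℕ< a<m
    row-gap : toℕ i ≡ 0 + suc a
    row-gap = toℕ-fromℕ< a<m
    below : 1 ≤ toℕ i
    below = subst (1 ≤_) (sym row-gap) (s≤s z≤n)

  -- Shift (a+1 , -(n-1)): the last row of B starts with 1, rows of A end with 0.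
  no-corner-overlap : ∀ {m} (A B : Matrix m n) {a} → InL m n u A → InL m n u B →
    suc (suc a) ≤ m → ¬ OverlapAt A B (+ suc a) -[1+ N ]
  no-corner-overlap A B {a} LA LB (s≤s {n = m'} a<m') ov = ones-vs-zeros
    (last-row-starts-with-1 (last-row B LB bottom (cong suc (toℕ-fromℕ m'))))
    (row-tail A LA top)
    (overlap-rows⁻ A B ov rows-apart 1 refl)
    where
    bottom = fromℕ m'
    top-index : m' ∸ suc a < suc m'
    top-index = s≤s (m∸n≤m m' (suc a))
    top = fromℕ< top-index
    rows-apart : toℕ bottom ≡ toℕ top + suc a
    rows-apart = trans (toℕ-fromℕ m')
      (sym (trans (cong (_+ suc a) (toℕ-fromℕ< top-index)) (m∸n+n≡m a<m')))

  -- Shift (a+1 , -(k+1)): row a+1 of B against the first row R of A.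
  no-vertical-overlap⁻ : ∀ {m} (A B : Matrix m n) {a k} → InL m n u A → InL m n u B →
    suc (suc a) ≤ m → suc (suc k) ≤ n → ¬ OverlapAt A B (+ suc a) -[1+ k ]
  no-vertical-overlap⁻ A B {a} {k} LA LB a<m@(s≤s _) (s≤s (s≤s k≤N)) ov with complement k≤N
  ... | zero , k≡N =
    no-corner-overlap A B LA LB a<m (subst (λ l → OverlapAt A B (+ suc a) -[1+ l ]) k≡N ov)
  ... | suc j , sj+k≡N = row-prefix≢frame-suffix (lower-row-is-middle B LB i below) j k j+sk≡N
      (begin
        take (2 + j) (row B i)     ≡⟨ overlap-rows⁻ A B ov (toℕ-fromℕ< a<m) (2 + j) lengths ⟩
        drop (suc k) (row A fzero) ≡⟨ cong (drop (suc k)) (first-row A LA fzero refl) ⟩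
        drop (suc k) R             ∎)
    where
    open ≡-Reasoning
    j+sk≡N : j + suc k ≡ N
    j+sk≡N = trans (+-suc j k) sj+k≡N
    lengths : 2 + j + suc k ≡ n
    lengths = cong (λ l → suc (suc l)) j+sk≡N
    i = fromℕ< a<m
    below : 1 ≤ toℕ i
    below = subst (1 ≤_) (sym (toℕ-fromℕ< a<m)) (s≤s z≤n)

  no-vertical-overlap : ∀ {m} (A B : Matrix m n) {a} → InL m n u A → InL m n u B →
    suc (suc a) ≤ m → ∀ q → suc ∣ q ∣ ≤ n → ¬ OverlapAt A B (+ suc a) q
  no-vertical-overlap A B LA LB a<m (+ k)     q<n = no-vertical-overlap⁺ A B LA LB a<m q<n
  no-vertical-overlap A B LA LB a<m -[1+ k ] q<n = no-vertical-overlap⁻ A B LA LB a<m q<n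

  overlap⇒origin : ∀ {m} (A B : Matrix m n) p q → InL m n u A → InL m n u B →
    AdmissibleShift m n p q → OverlapAt A B p q → p ≡ + 0 × q ≡ + 0
  overlap⇒origin A B (+ zero) (+ zero)   _  _  _   _  = refl , refl
  overlap⇒origin A B (+ zero) (+ suc k)  LA LB adm ov = ⊥-elim (no-horizontal-overlap A B LA LB adm ov)
  overlap⇒origin A B (+ zero) -[1+ k ]   LA LB adm ov =
    ⊥-elim (no-horizontal-overlap B A LB LA adm (overlap-sym A B (+ 0) -[1+ k ] ov))
  overlap⇒origin A B (+ suc a) q         LA LB (a<m , q<n) ov =
    ⊥-elim (no-vertical-overlap A B LA LB a<m q q<n ov)
  overlap⇒origin A B -[1+ a ] q          LA LB (a<m , q<n) ov =
    ⊥-elim (no-vertical-overlap B A LB LA a<m (ℤ.- q) neg-q-fits (overlap-sym A B -[1+ a ] q ov))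
    where
    neg-q-fits : suc ∣ ℤ.- q ∣ ≤ n
    neg-q-fits = subst (λ r → suc r ≤ n) (sym (ℤP.∣-i∣≡∣i∣ q)) q<n

  overlap⇒equal : ∀ {m} (A B : Matrix m n) p q → InL m n u A → InL m n u B →
    AdmissibleShift m n p q → OverlapAt A B p q → A ≡ B
  overlap⇒equal A B p q LA LB adm ov with overlap⇒origin A B p q LA LB adm ov
  ... | refl , refl = overlap-at-origin⇒≡ A B ov

proposition1 : (m n : ℕ) → 2 ≤ m → 4 ≤ n → Σ ℕ (λ k → n ≡ 2 * k) →
    (u : List Bool) → IsDyck (n Data.Nat.∸ 2) u →
    NonOverlappingSet (InL m n u)
proposition1 m (suc (suc N)) _ (s≤s (s≤s _)) _ u du =
    (λ A LA p q adm nontrivial ov → nontrivial (overlap⇒origin A A p q LA LA adm ov))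
  , (λ A B LA LB A≢B p q adm ov → A≢B (overlap⇒equal A B p q LA LB adm ov))
  where open Rows N u du
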